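{- Let $m$ and $M$ be two positive integers, and let $$\chi ( \llbracket -m,M \rrbracket) = \sup_{x,y \in \llbracket -m,M \rrbracket,\ xy < 0} \frac{|x|+|y|}{\gcd(x,y)}.$$ Then $\chi ( \llbracket -m,M \rrbracket) = m+M- \rho (m,M)$.
   Context: For integers $a\le b$, $\llbracket a,b\rrbracket$ denotes the set of integers $i$ with $a\le i\le b$. For positive integers $m,M$ define $$\rho(m,M)=\min\{t\in\mathbb{Z}_{\ge 0} : \text{there is } t'\in\mathbb{Z}_{\ge0},\ 0\le t'\le t,\ \gcd(M-t',\,m-(t-t'))=1\}.$$ -}

module Defs where

open import Data.Nat as ℕ using (ℕ; zero; suc)
open import Data.Nat.DivMod using (_/_)
open import Data.Integer as ℤ using (ℤ; +_; -_; ∣_∣)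
open import Data.Integer.GCD using (gcd)
open import Data.Product using (Σ; _×_; ∃-syntax)
open import Relation.Binary.PropositionalEquality using (_≡_)

_∈⟦_,_⟧ : ℤ → ℤ → ℤ → Set
x ∈⟦ a , b ⟧ = (a ℤ.≤ x) × (x ℤ.≤ b)

-- exact natural division guarded against a zero divisor (never zero where used)
_÷_ : ℕ → ℕ → ℕ
n ÷ zero = zero
n ÷ suc g = n / suc g

ratio : ℤ → ℤ → ℕ
ratio x y = (∣ x ∣ ℕ.+ ∣ y ∣) ÷ ∣ gcd x y ∣

RhoCond : ℕ → ℕ → ℕ → Set
RhoCond m M t = ∃[ t' ] (t' ℕ.≤ t) ×
  (gcd (+ M ℤ.- + t') (+ m ℤ.- (+ t ℤ.- + t')) ≡ + 1)

IsRho : ℕ → ℕ → ℕ → Set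
IsRho m M r = RhoCond m M r × (∀ t → RhoCond m M t → r ℕ.≤ t)

-- c = χ(⟦-m,M⟧) = sup of ratio x y over x,y ∈ ⟦-m,M⟧ with xy < 0
-- (a finite nonempty set of naturals, so sup = max: an attained upper bound)
IsChi : ℕ → ℕ → ℕ → Set
IsChi m M c =
  (∀ x y → x ∈⟦ - + m , + M ⟧ → y ∈⟦ - + m , + M ⟧ → x ℤ.* y ℤ.< + 0 → ratio x y ℕ.≤ c)
  × (∃[ x ] ∃[ y ] (x ∈⟦ - + m , + M ⟧) × (y ∈⟦ - + m , + M ⟧) × (x ℤ.* y ℤ.< + 0) × (ratio x y ≡ c))

{-# OPTIONS --safe #-}
module Submission where

-- For x > 0 > y, write |x| = g p and |y| = g q with g = gcd(x,y); then the ratio is p + q with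
-- p, q coprime, p ≤ M, q ≤ m.  Conversely every such pair is realised by x = p, y = -q.  So χ is
-- the largest p + q over coprime p ≤ M, q ≤ m, and the substitution p = M - t', q = m - (t - t')
-- turns maximising p + q = m + M - t into minimising t, which is ρ(m,M).

open import Defs
open import Data.Nat using (ℕ; suc; _+_; _∸_; _≤_; _<_; s≤s; z≤n; z<s; NonZero; ≢-nonZero; ≢-nonZero⁻¹; >-nonZero⁻¹)
open import Data.Integer as ℤ using (+_; ∣_∣; -[1+_]; +[1+_]; +≤+; -≤+; +<+; -<+)
import Data.Integer.Properties as ℤ
open import Data.Integer.GCD using (gcd)
open import Data.Nat.Coprimality using (Coprime; coprime⇒gcd≡1; gcd≡1⇒coprime; coprime-/gcd; 1-coprimeTo)
import Data.Nat.Coprimality as Coprime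
open import Data.Nat.DivMod using (_/_; n/1≡n; m/n≤m; +-distrib-/-∣ˡ)
import Data.Nat.GCD as ℕ
open import Data.Nat.Properties
open import Algebra.Properties.CommutativeSemigroup +-commutativeSemigroup using (interchange)
open import Data.Product using (_×_; _,_; proj₁; proj₂; ∃₂; ∃-syntax)
open import Data.Sum using (inj₁)
open import Relation.Binary.PropositionalEquality
open import Relation.Nullary using (contradiction)

m-n≡m∸n : ∀ {m n} → n ≤ m → + m ℤ.- + n ≡ + (m ∸ n)
m-n≡m∸n {m} {n} n≤m = trans (ℤ.m-n≡m⊖n m n) (ℤ.⊖-≥ n≤m)

÷≡/ : ∀ n d .{{_ : NonZero d}} → n ÷ d ≡ n / d
÷≡/ n (suc d) = refl

ratio-comm : ∀ x y → ratio x y ≡ ratio y x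
ratio-comm x y = cong₂ _÷_ (+-comm ∣ x ∣ ∣ y ∣) (ℕ.gcd-comm ∣ x ∣ ∣ y ∣)

complement-sum : ∀ {p q m M} → p ≤ M → q ≤ m → m + M ∸ ((M ∸ p) + (m ∸ q)) ≡ p + q
complement-sum {p} {q} {m} {M} p≤M q≤m = begin
  m + M ∸ t                           ≡⟨ cong (_∸ t) (+-comm m M) ⟩
  M + m ∸ t                           ≡⟨ cong₂ (λ a b → a + b ∸ t) (m+[n∸m]≡n p≤M) (m+[n∸m]≡n q≤m) ⟨
  (p + (M ∸ p)) + (q + (m ∸ q)) ∸ t   ≡⟨ cong (_∸ t) (interchange p (M ∸ p) q (m ∸ q)) ⟩
  (p + q) + t ∸ t                     ≡⟨ m+n∸n≡m (p + q) t ⟩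
  p + q                               ∎
  where
  open ≡-Reasoning
  t = (M ∸ p) + (m ∸ q)

module _ {m M : ℕ} where

  rhoCond-gcd : ∀ {t t'} → t' ≤ M → t' ≤ t → t ∸ t' ≤ m →
                gcd (+ M ℤ.- + t') (+ m ℤ.- (+ t ℤ.- + t')) ≡ + ℕ.gcd (M ∸ t') (m ∸ (t ∸ t'))
  rhoCond-gcd t'≤M t'≤t s≤m =
    cong₂ gcd (m-n≡m∸n t'≤M) (trans (cong (λ i → + m ℤ.- i) (m-n≡m∸n t'≤t)) (m-n≡m∸n s≤m))

  coprime⇒rhoCond : ∀ {p q} → p ≤ M → q ≤ m → Coprime p q → RhoCond m M ((M ∸ p) + (m ∸ q))
  coprime⇒rhoCond {p} {q} p≤M q≤m coprime = M ∸ p , m≤m+n (M ∸ p) (m ∸ q) , (begin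
    gcd (+ M ℤ.- + (M ∸ p)) (+ m ℤ.- (+ t ℤ.- + (M ∸ p)))
      ≡⟨ rhoCond-gcd (m∸n≤m M p) (m≤m+n (M ∸ p) (m ∸ q)) (subst (_≤ m) (sym t∸t'≡m∸q) (m∸n≤m m q)) ⟩
    + ℕ.gcd (M ∸ (M ∸ p)) (m ∸ (t ∸ (M ∸ p)))
      ≡⟨ cong₂ (λ a b → + ℕ.gcd a (m ∸ b)) (m∸[m∸n]≡n p≤M) t∸t'≡m∸q ⟩
    + ℕ.gcd p (m ∸ (m ∸ q))
      ≡⟨ cong (λ b → + ℕ.gcd p b) (m∸[m∸n]≡n q≤m) ⟩
    + ℕ.gcd p q
      ≡⟨ cong +_ (coprime⇒gcd≡1 coprime) ⟩
    + 1 ∎)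
    where
    open ≡-Reasoning
    t = (M ∸ p) + (m ∸ q)
    t∸t'≡m∸q : t ∸ (M ∸ p) ≡ m ∸ q
    t∸t'≡m∸q = m+n∸m≡n (M ∸ p) (m ∸ q)

  rhoCond⇒coprime-pair : ∀ {t} → t < M → t < m → RhoCond m M t →
    ∃₂ λ p q → 0 < p × 0 < q × p ≤ M × q ≤ m × Coprime p q × p + q ≡ m + M ∸ t
  rhoCond⇒coprime-pair {t} t<M t<m (t' , t'≤t , gcd≡1) =
    M ∸ t' , m ∸ s ,
    m<n⇒0<n∸m (≤-<-trans t'≤t t<M) , m<n⇒0<n∸m (≤-<-trans s≤t t<m) ,
    m∸n≤m M t' , m∸n≤m m s ,
    gcd≡1⇒coprime (ℤ.+-injective (trans (sym (rhoCond-gcd t'≤M t'≤t s≤m)) gcd≡1)) ,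
    sym sum≡
    where
    s = t ∸ t'
    s≤t : s ≤ t
    s≤t = m∸n≤m t t'
    t'≤M : t' ≤ M
    t'≤M = <⇒≤ (≤-<-trans t'≤t t<M)
    s≤m : s ≤ m
    s≤m = <⇒≤ (≤-<-trans s≤t t<m)
    sum≡ : m + M ∸ t ≡ (M ∸ t') + (m ∸ s)
    sum≡ = begin
      m + M ∸ t                                    ≡⟨ cong (m + M ∸_) (m+[n∸m]≡n t'≤t) ⟨
      m + M ∸ (t' + s)                             ≡⟨ cong₂ (λ a b → m + M ∸ (a + b)) (m∸[m∸n]≡n t'≤M) (m∸[m∸n]≡n s≤m) ⟨
      m + M ∸ ((M ∸ (M ∸ t')) + (m ∸ (m ∸ s)))     ≡⟨ complement-sum (m∸n≤m M t') (m∸n≤m m s) ⟩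
      (M ∸ t') + (m ∸ s)                           ∎
      where open ≡-Reasoning

  coprime-pair-attained : ∀ {p q} → 0 < p → 0 < q → p ≤ M → q ≤ m → Coprime p q →
    ∀ {c} → p + q ≡ c →
    ∃[ x ] ∃[ y ] (x ∈⟦ ℤ.- + m , + M ⟧) × (y ∈⟦ ℤ.- + m , + M ⟧) × (x ℤ.* y ℤ.< + 0) × (ratio x y ≡ c)
  coprime-pair-attained {suc a} {suc b} (s≤s z≤n) (s≤s z≤n) p≤M q≤m coprime p+q≡c =
    +[1+ a ] , -[1+ b ] ,
    (ℤ.neg-≤-pos , +≤+ p≤M) , (ℤ.neg-mono-≤ (+≤+ q≤m) , -≤+) , -<+ ,
    trans (cong (λ g → (suc a + suc b) ÷ g) (coprime⇒gcd≡1 coprime)) (trans (n/1≡n (suc a + suc b)) p+q≡c)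

  module _ {r : ℕ} (rho : IsRho m M r) where

    rho≤complement : ∀ {p q} → p ≤ M → q ≤ m → Coprime p q → r ≤ (M ∸ p) + (m ∸ q)
    rho≤complement p≤M q≤m coprime = proj₂ rho _ (coprime⇒rhoCond p≤M q≤m coprime)

    rho<M : .{{NonZero M}} → r < M
    rho<M = begin-strict
      r                     ≤⟨ rho≤complement (>-nonZero⁻¹ M) ≤-refl (1-coprimeTo m) ⟩
      (M ∸ 1) + (m ∸ m)     ≡⟨ cong (λ k → (M ∸ 1) + k) (n∸n≡0 m) ⟩
      (M ∸ 1) + 0           ≡⟨ +-identityʳ (M ∸ 1) ⟩
      M ∸ 1                 <⟨ ∸-monoʳ-< z<s (>-nonZero⁻¹ M) ⟩
      M                     ∎
      where open ≤-Reasoning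

    rho<m : .{{NonZero m}} → r < m
    rho<m = begin-strict
      r                     ≤⟨ rho≤complement ≤-refl (>-nonZero⁻¹ m) (Coprime.sym (1-coprimeTo M)) ⟩
      (M ∸ M) + (m ∸ 1)     ≡⟨ cong (_+ (m ∸ 1)) (n∸n≡0 M) ⟩
      m ∸ 1                 <⟨ ∸-monoʳ-< z<s (>-nonZero⁻¹ m) ⟩
      m                     ∎
      where open ≤-Reasoning

    coprime-sum≤ : ∀ {p q} → p ≤ M → q ≤ m → Coprime p q → p + q ≤ m + M ∸ r
    coprime-sum≤ {p} {q} p≤M q≤m coprime = begin
      p + q                       ≡⟨ complement-sum p≤M q≤m ⟨
      m + M ∸ ((M ∸ p) + (m ∸ q)) ≤⟨ ∸-monoʳ-≤ (m + M) (rho≤complement p≤M q≤m coprime) ⟩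
      m + M ∸ r                   ∎
      where open ≤-Reasoning

    reduced-sum≤ : ∀ {A B} → .{{NonZero A}} → A ≤ M → B ≤ m → (A + B) ÷ ℕ.gcd A B ≤ m + M ∸ r
    reduced-sum≤ {A} {B} A≤M B≤m = begin
      (A + B) ÷ g     ≡⟨ ÷≡/ (A + B) g ⟩
      (A + B) / g     ≡⟨ +-distrib-/-∣ˡ B (ℕ.gcd[m,n]∣m A B) ⟩
      A / g + B / g   ≤⟨ coprime-sum≤ (≤-trans (m/n≤m A g) A≤M) (≤-trans (m/n≤m B g) B≤m) (coprime-/gcd A B) ⟩
      m + M ∸ r       ∎
      where
      open ≤-Reasoning
      g = ℕ.gcd A B
      instance
        g≢0 : NonZero g
        g≢0 = ≢-nonZero (ℕ.gcd[m,n]≢0 A B (inj₁ (≢-nonZero⁻¹ A)))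

    ratio≤ : ∀ x y → x ∈⟦ ℤ.- + m , + M ⟧ → y ∈⟦ ℤ.- + m , + M ⟧ → x ℤ.* y ℤ.< + 0 →
             ratio x y ≤ m + M ∸ r
    ratio≤ +[1+ a ] -[1+ b ] (_ , +≤+ x≤M) (-m≤y , _) _ =
      reduced-sum≤ x≤M (ℤ.drop‿+≤+ (ℤ.neg-cancel-≤ -m≤y))
    ratio≤ -[1+ a ] +[1+ b ] (-m≤x , _) (_ , +≤+ y≤M) _ =
      subst (_≤ m + M ∸ r) (ratio-comm +[1+ b ] -[1+ a ])
        (reduced-sum≤ y≤M (ℤ.drop‿+≤+ (ℤ.neg-cancel-≤ -m≤x)))
    ratio≤ (+ 0)      _         _ _ (+<+ ())
    ratio≤ -[1+ _ ]   -[1+ _ ]  _ _ (+<+ ())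
    ratio≤ +[1+ a ]   (+ n)     _ _ xy<0 =
      contradiction (subst (ℤ._< + 0) (sym (ℤ.pos-* (suc a) n)) xy<0) ℤ.+≮0
    ratio≤ -[1+ a ]   (+ 0)     _ _ xy<0 =
      contradiction (subst (ℤ._< + 0) (ℤ.*-zeroʳ -[1+ a ]) xy<0) ℤ.+≮0

proposition1p3 : (m M : ℕ) → .{{NonZero m}} → .{{NonZero M}} →
    (r : ℕ) → IsRho m M r → IsChi m M ((m + M) ∸ r)
proposition1p3 m M r rho =
  let (_ , _ , 0<p , 0<q , p≤M , q≤m , coprime , p+q≡χ) = rhoCond⇒coprime-pair (rho<M rho) (rho<m rho) (proj₁ rho)
  in ratio≤ rho , coprime-pair-attained 0<p 0<q p≤M q≤m coprime p+q≡χ
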